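{- Let $G'=(V',E')$ be a graph, $V\subsetneq V'$, $G=G'[V]$, and let $S$ be a power dominating set of $G$. Suppose each connected component of $G'[V'\setminus V]$ has at least $3$ vertices. Then \[\gamma_P(G';S)\le |S|+\frac{|V'\setminus V|}{3}+\bigl|N_{G'}[V\setminus N_G[S]]\cap (V'\setminus V)\bigr|,\] and this bound is tight, i.e., there exist such $G'$, $V$, $S$ for which equality holds.
   Context: All graphs are finite, simple and undirected; $H[W]$ is the subgraph of $H$ induced by $W$. $N_H(v)$ denotes the neighbors of $v$ in $H$, $N_H[v]=N_H(v)\cup\{v\}$, $N_H[S]=\bigcup_{v\in S}N_H[v]$. For $S\subseteq V(H)$, the set $PD(S)$ is defined by: initially $PD(S)=N_H[S]$; while there exists $v\in PD(S)$ with $|N_H(v)\setminus PD(S)|=1$, replace $PD(S)$ by $PD(S)\cup N_H(v)$. $S$ is a power dominating set of $H$ if at the end $PD(S)=V(H)$. $\gamma_P(H;X)$ is the minimum size of a power dominating set of $H$ containing $X$. -}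

module Defs where

open import Data.Nat using (ℕ; _≤_; _*_; _+_)
open import Data.Bool using (Bool; true; false; _∧_; _∨_; not)
open import Data.Fin using (Fin)
open import Data.Fin.Subset public using (Subset; _∈_; _∉_; _⊆_; ⊤; ∁; _∩_; _─_; ∣_∣)
open import Data.Vec using (lookup; tabulate)
open import Data.List using (allFin)
open import Data.Bool.ListAction using (any)
open import Data.Product using (Σ; ∃; _×_; _,_)
open import Relation.Binary.PropositionalEquality using (_≡_; _≢_)

record Graph (n : ℕ) : Set where
  field
    Adj    : Fin n → Fin n → Bool
    sym    : ∀ u v → Adj u v ≡ Adj v u
    irrefl : ∀ v → Adj v v ≡ false
open Graph public

module _ {n : ℕ} (G : Graph n) where

  -- Throughout, (G , W) denotes the induced subgraph G[W] (vertex set W,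
  -- edges of G between vertices of W); vertex labels are shared with G.

  AdjIn : Subset n → Fin n → Fin n → Bool
  AdjIn W u v = lookup W u ∧ lookup W v ∧ Adj G u v

  NCl : Subset n → Subset n → Subset n
  NCl W S = tabulate λ y → lookup W y ∧
              (lookup S y ∨ any (λ s → lookup S s ∧ AdjIn W s y) (allFin n))

  data InPD (W S : Subset n) : Fin n → Set where
    base  : ∀ {v} → v ∈ NCl W S → InPD W S v
    force : ∀ {v w} → InPD W S v → AdjIn W v w ≡ true →
            (∀ u → AdjIn W v u ≡ true → u ≢ w → InPD W S u) →
            InPD W S w

  IsPDS : Subset n → Subset n → Set
  IsPDS W S = S ⊆ W × (∀ v → v ∈ W → InPD W S v)

  IsGammaP : Subset n → Subset n → ℕ → Set
  IsGammaP W X k =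
    (∃ λ T → X ⊆ T × IsPDS W T × ∣ T ∣ ≡ k) ×
    (∀ T → X ⊆ T → IsPDS W T → k ≤ ∣ T ∣)

  data Reach (W : Subset n) : Fin n → Fin n → Set where
    here : ∀ {v} → v ∈ W → Reach W v v
    step : ∀ {u v w} → Reach W u v → AdjIn W v w ≡ true → Reach W u w

  ComponentsAtLeast3 : Subset n → Set
  ComponentsAtLeast3 W = ∀ v → v ∈ W →
    ∃ λ a → ∃ λ b → ∃ λ c → a ≢ b × a ≢ c × b ≢ c ×
      Reach W v a × Reach W v b × Reach W v c

  -- N_{G'}[V ∖ N_G[S]] ∩ (V' ∖ V), where G' = G (vertex set ⊤), G = G'[V]
  Boundary : Subset n → Subset n → Subset n
  Boundary V S = NCl ⊤ (V ─ NCl V S) ∩ ∁ V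

  Setting : Subset n → Subset n → Set
  Setting V S = (∃ λ x → x ∉ V) × IsPDS V S × ComponentsAtLeast3 (∁ V)

  -- 3 · RHS of the bound  |S| + |V'∖V|/3 + |Boundary|
  ThreeBound : Subset n → Subset n → ℕ
  ThreeBound V S = 3 * ∣ S ∣ + ∣ ∁ V ∣ + 3 * ∣ Boundary V S ∣

-- Let C = V′ ∖ V and B = N_{G′}[V ∖ N_G[S]] ∩ C. If D power dominates G′[C], then S ∪ B ∪ D power
-- dominates G′: forcing inside G′[C] is undisturbed, because a vertex of C outside B has all its
-- neighbours in V inside N_G[S]; once C is observed, forcing inside G[V] is undisturbed as well.
-- So it suffices to find such a D with |D| ≤ |C|/3, i.e. γ_P(H) ≤ |H|/3 whenever every component
-- of H has at least 3 vertices. This goes by induction: a component K contains a piece X and a set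
-- D₀ ⊆ X with 3|D₀| ≤ |X| that dominates every vertex of X with a neighbour outside X and observes X
-- given the rest, while K ∖ X is empty or a component of size ≥ 3. To find X, move a hub v through
-- K until every component (branch) of Y − v has at most two vertices, where Y ∋ v is connected and
-- K ∖ Y is connected and adjacent to v; then N[v] observes Y up to one force per branch, and a case
-- analysis on |K ∖ Y| (ending in a five-vertex configuration) finishes. Equality holds for an
-- isolated vertex V = S beside a path on three vertices.

module Submission where

open import Defs hiding (sym)
open import Level using (0ℓ)
open import Data.Nat using (ℕ; zero; suc; _≤_; _<_; _*_; _+_; z≤n; s≤s; _<?_; _≤?_)
open import Data.Nat.Properties
  using (≤-trans; ≤-reflexive; ≤-pred; 1+n≰n; ≰⇒>; ≮⇒≥; n≤1+n; +-suc; +-cancelʳ-≤;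
         +-monoˡ-≤; +-monoʳ-≤; +-mono-≤; *-monoʳ-≤; *-distribˡ-+; module ≤-Reasoning)
open import Data.Nat.Induction using (<-wellFounded)
open import Data.Nat.Solver using (module +-*-Solver)
open import Data.Bool using (Bool; true; false; _∧_; _∨_)
open import Data.Bool.Properties using (∧-conicalˡ; ∧-conicalʳ; ∨-zeroʳ; ∨-comm) renaming (_≟_ to _≟ᵇ_)
open import Data.Fin using (Fin; zero; suc)
open import Data.Fin.Properties using (any?; all?) renaming (_≟_ to _≟ᶠ_)
open import Data.Fin.Subset
  using (Subset; _∈_; _∉_; _⊆_; _⊂_; _⊃_; ⊤; ⊥; ∁; _∩_; _∪_; _─_; ∣_∣; ⁅_⁆; Nonempty; Empty)
open import Data.Fin.Subset.Properties
open import Data.Fin.Subset.Induction using (⊂-wellFounded; ⊃-wellFounded)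
open import Data.Vec using ([]; _∷_; lookup; tabulate; here; there)
open import Data.Vec.Properties using ([]=⇒lookup; lookup⇒[]=; lookup∘tabulate)
open import Data.List using ([]; _∷_; allFin)
open import Data.List.Membership.Propositional using () renaming (_∈_ to _∈ₗ_)
open import Data.List.Membership.Propositional.Properties using (∈-allFin)
open import Data.List.Relation.Unary.Any using () renaming (here to hereₗ; there to thereₗ)
open import Data.Bool.ListAction using (any)
open import Data.Product using (Σ; ∃; _×_; _,_; proj₁; proj₂)
open import Data.Sum using (_⊎_; inj₁; inj₂; [_,_]′)
import Data.Sum as Sum
open import Data.Empty using (⊥-elim)
open import Function using (id; _∘_; case_of_)
open import Induction.WellFounded using (Acc; acc)
open import Relation.Nullary using (Dec; yes; no; ¬_; does; _×-dec_; _→-dec_)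
open import Relation.Nullary.Decidable using (¬?; dec-true; map′)
open import Relation.Unary using (Pred; Decidable)
open import Relation.Binary.PropositionalEquality using (_≡_; _≢_; refl; sym; trans; cong; cong₂; subst)

-- Booleans and finite subsets

∧-true⁺ : ∀ {x y} → x ≡ true → y ≡ true → x ∧ y ≡ true
∧-true⁺ refl refl = refl

∨-true : ∀ {x y} → x ∨ y ≡ true → x ≡ true ⊎ y ≡ true
∨-true {true}  _ = inj₁ refl
∨-true {false} p = inj₂ p

any-true⁻ : ∀ {A : Set} (f : A → Bool) xs → any f xs ≡ true → ∃ λ x → f x ≡ true
any-true⁻ f (x ∷ xs) p with f x in eq
... | true  = x , eq
... | false = any-true⁻ f xs p

any-true⁺ : ∀ {A : Set} (f : A → Bool) {x xs} → x ∈ₗ xs → f x ≡ true → any f xs ≡ true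
any-true⁺ f (hereₗ refl) fx rewrite fx = refl
any-true⁺ f {xs = y ∷ _} (thereₗ x∈) fx with f y
... | true  = refl
... | false = any-true⁺ f x∈ fx

private
  variable
    n : ℕ
    p q : Subset n
    x y z : Fin n

subsetOf : {P : Pred (Fin n) 0ℓ} → Decidable P → Subset n
subsetOf P? = tabulate (does ∘ P?)

∈-subsetOf⁺ : {P : Pred (Fin n) 0ℓ} (P? : Decidable P) {x : Fin n} → P x → x ∈ subsetOf P?
∈-subsetOf⁺ P? {x} px = lookup⇒[]= x _ (trans (lookup∘tabulate (does ∘ P?) x) (dec-true (P? x) px))

∈-subsetOf⁻ : {P : Pred (Fin n) 0ℓ} (P? : Decidable P) {x : Fin n} → x ∈ subsetOf P? → P x
∈-subsetOf⁻ P? {x} x∈ = reflect (P? x) (trans (sym (lookup∘tabulate (does ∘ P?) x)) ([]=⇒lookup x∈))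
  where
  reflect : ∀ {A} (a? : Dec A) → does a? ≡ true → A
  reflect (yes a) _ = a

x∈p─q⇒x∉q : x ∈ p ─ q → x ∉ q
x∈p─q⇒x∉q {x = zero} {p = _ ∷ _} {q = true  ∷ _} ()
x∈p─q⇒x∉q {x = zero} {p = _ ∷ _} {q = false ∷ _} _ ()
x∈p─q⇒x∉q {x = suc _} {p = _ ∷ _} {q = _ ∷ _} (there x∈) (there x∈q) = x∈p─q⇒x∉q x∈ x∈q

∣p∣≡∣p∩q∣+∣p─q∣ : (p q : Subset n) → ∣ p ∣ ≡ ∣ p ∩ q ∣ + ∣ p ─ q ∣
∣p∣≡∣p∩q∣+∣p─q∣ [] [] = refl
∣p∣≡∣p∩q∣+∣p─q∣ (true  ∷ p) (true  ∷ q) = cong suc (∣p∣≡∣p∩q∣+∣p─q∣ p q)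
∣p∣≡∣p∩q∣+∣p─q∣ (true  ∷ p) (false ∷ q) = trans (cong suc (∣p∣≡∣p∩q∣+∣p─q∣ p q)) (sym (+-suc _ _))
∣p∣≡∣p∩q∣+∣p─q∣ (false ∷ p) (true  ∷ q) = ∣p∣≡∣p∩q∣+∣p─q∣ p q
∣p∣≡∣p∩q∣+∣p─q∣ (false ∷ p) (false ∷ q) = ∣p∣≡∣p∩q∣+∣p─q∣ p q

∣p∪q∣≤∣p∣+∣q∣ : (p q : Subset n) → ∣ p ∪ q ∣ ≤ ∣ p ∣ + ∣ q ∣
∣p∪q∣≤∣p∣+∣q∣ [] [] = z≤n
∣p∪q∣≤∣p∣+∣q∣ (true  ∷ p) (true  ∷ q) = s≤s (≤-trans (∣p∪q∣≤∣p∣+∣q∣ p q) (+-monoʳ-≤ ∣ p ∣ (n≤1+n ∣ q ∣)))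
∣p∪q∣≤∣p∣+∣q∣ (true  ∷ p) (false ∷ q) = s≤s (∣p∪q∣≤∣p∣+∣q∣ p q)
∣p∪q∣≤∣p∣+∣q∣ (false ∷ p) (true  ∷ q) = ≤-trans (s≤s (∣p∪q∣≤∣p∣+∣q∣ p q)) (≤-reflexive (sym (+-suc _ _)))
∣p∪q∣≤∣p∣+∣q∣ (false ∷ p) (false ∷ q) = ∣p∪q∣≤∣p∣+∣q∣ p q

infixl 5 _∖_

-- An opaque copy of _─_: its membership lemmas can then recover both operands by unification.
opaque
  _∖_ : Subset n → Subset n → Subset n
  p ∖ q = p ─ q

  x∈p∖q⁺ : x ∈ p → x ∉ q → x ∈ p ∖ q
  x∈p∖q⁺ = x∈p∧x∉q⇒x∈p─q

  x∈p∖q⁻ : x ∈ p ∖ q → x ∈ p × x ∉ q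
  x∈p∖q⁻ {p = p} {q = q} x∈ = p─q⊆p p q x∈ , x∈p─q⇒x∉q x∈

  ∣p∣≡∣q∣+∣p∖q∣ : q ⊆ p → ∣ p ∣ ≡ ∣ q ∣ + ∣ p ∖ q ∣
  ∣p∣≡∣q∣+∣p∖q∣ {q = q} {p = p} q⊆p =
    trans (∣p∣≡∣p∩q∣+∣p─q∣ p q) (cong (λ r → ∣ r ∣ + ∣ p ─ q ∣) p∩q≡q)
    where
    p∩q≡q : p ∩ q ≡ q
    p∩q≡q = ⊆-antisym (p∩q⊆q p q) (λ x∈q → x∈p∩q⁺ (q⊆p x∈q , x∈q))

p∖q⊆p : p ∖ q ⊆ p
p∖q⊆p = proj₁ ∘ x∈p∖q⁻

x∈p∖q⇒x∉q : x ∈ p ∖ q → x ∉ q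
x∈p∖q⇒x∉q = proj₂ ∘ x∈p∖q⁻

x∈p∖⁅y⁆⁺ : x ∈ p → x ≢ y → x ∈ p ∖ ⁅ y ⁆
x∈p∖⁅y⁆⁺ x∈p x≢y = x∈p∖q⁺ x∈p (x≢y⇒x∉⁅y⁆ x≢y)

x∈p∖⁅y⁆⇒x≢y : x ∈ p ∖ ⁅ y ⁆ → x ≢ y
x∈p∖⁅y⁆⇒x≢y = x∉⁅y⁆⇒x≢y ∘ x∈p∖q⇒x∉q

x∈p⇒⁅x⁆⊆p : x ∈ p → ⁅ x ⁆ ⊆ p
x∈p⇒⁅x⁆⊆p {x = x} {p = p} x∈p y∈ = subst (_∈ p) (sym (x∈⁅y⁆⇒x≡y x y∈)) x∈p

3*∣⁅x⁆∣≤∣p∣ : ∀ (x : Fin n) → 3 ≤ ∣ p ∣ → 3 * ∣ ⁅ x ⁆ ∣ ≤ ∣ p ∣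
3*∣⁅x⁆∣≤∣p∣ {p = p} x 3≤∣p∣ = subst (λ k → 3 * k ≤ ∣ p ∣) (sym (∣⁅x⁆∣≡1 x)) 3≤∣p∣

∣p∣≡1+∣p∖⁅x⁆∣ : x ∈ p → ∣ p ∣ ≡ suc ∣ p ∖ ⁅ x ⁆ ∣
∣p∣≡1+∣p∖⁅x⁆∣ {x = x} {p = p} x∈p =
  trans (∣p∣≡∣q∣+∣p∖q∣ (x∈p⇒⁅x⁆⊆p x∈p)) (cong (_+ ∣ p ∖ ⁅ x ⁆ ∣) (∣⁅x⁆∣≡1 x))

x∈p⇒1≤∣p∣ : x ∈ p → 1 ≤ ∣ p ∣
x∈p⇒1≤∣p∣ x∈p = subst (1 ≤_) (sym (∣p∣≡1+∣p∖⁅x⁆∣ x∈p)) (s≤s z≤n)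

distinct⇒2≤∣p∣ : x ∈ p → y ∈ p → x ≢ y → 2 ≤ ∣ p ∣
distinct⇒2≤∣p∣ x∈p y∈p x≢y =
  subst (2 ≤_) (sym (∣p∣≡1+∣p∖⁅x⁆∣ x∈p)) (s≤s (x∈p⇒1≤∣p∣ (x∈p∖⁅y⁆⁺ y∈p (x≢y ∘ sym))))

distinct⇒3≤∣p∣ : x ∈ p → y ∈ p → z ∈ p → x ≢ y → x ≢ z → y ≢ z → 3 ≤ ∣ p ∣
distinct⇒3≤∣p∣ x∈p y∈p z∈p x≢y x≢z y≢z =
  subst (3 ≤_) (sym (∣p∣≡1+∣p∖⁅x⁆∣ x∈p))
    (s≤s (distinct⇒2≤∣p∣ (x∈p∖⁅y⁆⁺ y∈p (x≢y ∘ sym)) (x∈p∖⁅y⁆⁺ z∈p (x≢z ∘ sym)) y≢z))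

∣p∣≤2⇒¬distinct₃ : ∣ p ∣ ≤ 2 → x ∈ p → y ∈ p → z ∈ p → x ≢ y → x ≢ z → y ≢ z → Data.Empty.⊥
∣p∣≤2⇒¬distinct₃ ∣p∣≤2 x∈p y∈p z∈p x≢y x≢z y≢z =
  1+n≰n (≤-trans (distinct⇒3≤∣p∣ x∈p y∈p z∈p x≢y x≢z y≢z) ∣p∣≤2)

1≤∣p∣⇒nonempty : ∀ {n} {p : Subset n} → 1 ≤ ∣ p ∣ → Nonempty p
1≤∣p∣⇒nonempty {n} {p} 1≤∣p∣ with nonempty? p
... | yes ne = ne
... | no empty = ⊥-elim (1+n≰n (subst (1 ≤_) (∣⊥∣≡0 n) (subst (λ r → 1 ≤ ∣ r ∣) (Empty-unique empty) 1≤∣p∣)))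

2≤∣p∣⇒distinct₂ : 2 ≤ ∣ p ∣ → ∃ λ x → ∃ λ y → x ∈ p × y ∈ p × x ≢ y
2≤∣p∣⇒distinct₂ 2≤∣p∣ with 1≤∣p∣⇒nonempty (≤-trans (s≤s z≤n) 2≤∣p∣)
... | x , x∈p with 1≤∣p∣⇒nonempty (≤-pred (subst (2 ≤_) (∣p∣≡1+∣p∖⁅x⁆∣ x∈p) 2≤∣p∣))
... | y , y∈ = x , y , x∈p , p∖q⊆p y∈ , x∈p∖⁅y⁆⇒x≢y y∈ ∘ sym

3≤∣p∣⇒distinct₃ : 3 ≤ ∣ p ∣ → ∃ λ x → ∃ λ y → ∃ λ z → x ∈ p × y ∈ p × z ∈ p × x ≢ y × x ≢ z × y ≢ z
3≤∣p∣⇒distinct₃ 3≤∣p∣ with 1≤∣p∣⇒nonempty (≤-trans (s≤s z≤n) 3≤∣p∣)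
... | x , x∈p with 2≤∣p∣⇒distinct₂ (≤-pred (subst (3 ≤_) (∣p∣≡1+∣p∖⁅x⁆∣ x∈p) 3≤∣p∣))
... | y , z , y∈ , z∈ , y≢z =
  x , y , z , x∈p , p∖q⊆p y∈ , p∖q⊆p z∈ , x∈p∖⁅y⁆⇒x≢y y∈ ∘ sym , x∈p∖⁅y⁆⇒x≢y z∈ ∘ sym , y≢z

-- Least closures and minimum sizes

module Closure {n : ℕ} (Step : Subset n → Pred (Fin n) 0ℓ) (Step? : ∀ B → Decidable (Step B)) where

  record IsClosureOf (A C : Subset n) : Set₁ where
    field
      contains : A ⊆ C
      closed   : ∀ {x} → Step C x → x ∈ C
      induct   : (P : Pred (Fin n) 0ℓ) → (∀ {x} → x ∈ A → P x) →
                 (∀ {B x} → (∀ {y} → y ∈ B → P y) → Step B x → P x) →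
                 ∀ {x} → x ∈ C → P x

  private
    saturate : (A : Subset n) → Acc _⊃_ A → Σ (Subset n) (IsClosureOf A)
    saturate A (acc rec) with any? (λ x → Step? A x ×-dec ¬? (x ∈? A))
    ... | no stable = A , record { contains = id ; closed = closed ; induct = λ _ inA _ → inA }
      where
      closed : ∀ {x} → Step A x → x ∈ A
      closed {x} s with x ∈? A
      ... | yes x∈A = x∈A
      ... | no  x∉A = ⊥-elim (stable (x , s , x∉A))
    ... | yes (x , s , x∉A) =
      C , record { contains = A⊆C ; closed = IsClosureOf.closed C-closure ; induct = induct }
      where
      A⁺ : Subset n
      A⁺ = A ∪ subsetOf (Step? A)
      next = saturate A⁺ (rec (p⊆p∪q _ , x , x∈p∪q⁺ (inj₂ (∈-subsetOf⁺ (Step? A) s)) , x∉A))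
      C = proj₁ next
      C-closure = proj₂ next
      A⊆C : A ⊆ C
      A⊆C = IsClosureOf.contains C-closure ∘ p⊆p∪q _
      induct : (P : Pred (Fin n) 0ℓ) → (∀ {x} → x ∈ A → P x) →
               (∀ {B x} → (∀ {y} → y ∈ B → P y) → Step B x → P x) → ∀ {x} → x ∈ C → P x
      induct P inA rule = IsClosureOf.induct C-closure P inA⁺ rule
        where
        inA⁺ : ∀ {y} → y ∈ A⁺ → P y
        inA⁺ y∈ with x∈p∪q⁻ A _ y∈
        ... | inj₁ y∈A = inA y∈A
        ... | inj₂ y∈S = rule inA (∈-subsetOf⁻ (Step? A) y∈S)

  closure : (A : Subset n) → Σ (Subset n) (IsClosureOf A)
  closure A = saturate A (⊃-wellFounded A)

module _ {n : ℕ} {Q : Pred (Subset n) 0ℓ} (Q? : Decidable Q) where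

  MinimumSize : ℕ → Set
  MinimumSize k = (∃ λ T → Q T × ∣ T ∣ ≡ k) × (∀ T → Q T → k ≤ ∣ T ∣)

  minimumSize : ∀ T → Q T → ∃ MinimumSize
  minimumSize T₀ qT₀ = descend T₀ qT₀ (<-wellFounded ∣ T₀ ∣)
    where
    descend : ∀ T → Q T → Acc _<_ ∣ T ∣ → ∃ MinimumSize
    descend T qT (acc rec) with anySubset? (λ U → Q? U ×-dec ∣ U ∣ <? ∣ T ∣)
    ... | yes (U , qU , smaller) = descend U qU (rec smaller)
    ... | no  none = ∣ T ∣ , (T , qT , refl) , λ U qU → ≮⇒≥ (λ smaller → none (U , qU , smaller))

-- Graphs: edges, domination, reachability, forcing

module _ {n : ℕ} (G : Graph n) where

  infix 4 _~_

  _~_ : Fin n → Fin n → Set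
  u ~ v = Adj G u v ≡ true

  _~?_ : ∀ u v → Dec (u ~ v)
  u ~? v = Adj G u v ≟ᵇ true

  ~-sym : ∀ {u v} → u ~ v → v ~ u
  ~-sym {u} {v} u~v = trans (Graph.sym G v u) u~v

  ~⇒≢ : ∀ {u v} → u ~ v → u ≢ v
  ~⇒≢ {u} u~u refl with trans (sym u~u) (irrefl G u)
  ... | ()

  -- Propositional forms of AdjIn and NCl, whose Bool-valued definitions block unification.
  record Edge (W : Subset n) (u v : Fin n) : Set where
    constructor edge
    field
      tail∈ : u ∈ W
      head∈ : v ∈ W
      adj   : u ~ v

  open Edge public

  Edge-sym : ∀ {W u v} → Edge W u v → Edge W v u
  Edge-sym (edge u∈ v∈ u~v) = edge v∈ u∈ (~-sym u~v)

  Edge-mono : ∀ {W W′ u v} → W ⊆ W′ → Edge W u v → Edge W′ u v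
  Edge-mono W⊆W′ (edge u∈ v∈ u~v) = edge (W⊆W′ u∈) (W⊆W′ v∈) u~v

  Edge? : ∀ W u v → Dec (Edge W u v)
  Edge? W u v = map′ (λ (u∈ , v∈ , u~v) → edge u∈ v∈ u~v) (λ e → tail∈ e , head∈ e , adj e)
                     ((u ∈? W) ×-dec (v ∈? W) ×-dec (u ~? v))

  AdjIn⇒Edge : ∀ W u v → AdjIn G W u v ≡ true → Edge W u v
  AdjIn⇒Edge W u v e =
    edge (lookup⇒[]= u W (∧-conicalˡ (lookup W u) _ e))
         (lookup⇒[]= v W (∧-conicalˡ (lookup W v) _ v-adj))
         (∧-conicalʳ (lookup W v) _ v-adj)
    where
    v-adj : lookup W v ∧ Adj G u v ≡ true
    v-adj = ∧-conicalʳ (lookup W u) _ e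

  Edge⇒AdjIn : ∀ {W u v} → Edge W u v → AdjIn G W u v ≡ true
  Edge⇒AdjIn (edge u∈ v∈ u~v) rewrite []=⇒lookup u∈ | []=⇒lookup v∈ = u~v

  data Dominated (W S : Subset n) (x : Fin n) : Set where
    self : x ∈ W → x ∈ S → Dominated W S x
    nbr  : ∀ {s} → s ∈ S → Edge W s x → Dominated W S x

  dominated-by : ∀ {W d u} → d ∈ W → u ∈ W → u ≡ d ⊎ d ~ u → Dominated W ⁅ d ⁆ u
  dominated-by {d = d} d∈ u∈ (inj₁ refl) = self u∈ (x∈⁅x⁆ d)
  dominated-by {d = d} d∈ u∈ (inj₂ d~u)  = nbr (x∈⁅x⁆ d) (edge d∈ u∈ d~u)

  Dominated-mono : ∀ {W W′ S S′ x} → W ⊆ W′ → S ⊆ S′ → Dominated W S x → Dominated W′ S′ x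
  Dominated-mono W⊆W′ S⊆S′ (self x∈ x∈S) = self (W⊆W′ x∈) (S⊆S′ x∈S)
  Dominated-mono W⊆W′ S⊆S′ (nbr s∈S e)   = nbr (S⊆S′ s∈S) (Edge-mono W⊆W′ e)

  private
    dominatorᵇ : Subset n → Subset n → Fin n → Fin n → Bool
    dominatorᵇ W S y s = lookup S s ∧ AdjIn G W s y

    inNClᵇ : Subset n → Subset n → Fin n → Bool
    inNClᵇ W S y = lookup W y ∧ (lookup S y ∨ any (dominatorᵇ W S y) (allFin n))

  NCl⇒Dominated : ∀ W S x → x ∈ NCl G W S → Dominated W S x
  NCl⇒Dominated W S x x∈ = from (trans (sym (lookup∘tabulate (inNClᵇ W S) x)) ([]=⇒lookup x∈))
    where
    from : inNClᵇ W S x ≡ true → Dominated W S x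
    from holds with ∨-true (∧-conicalʳ (lookup W x) _ holds)
    ... | inj₁ x∈S = self (lookup⇒[]= x W (∧-conicalˡ (lookup W x) _ holds)) (lookup⇒[]= x S x∈S)
    ... | inj₂ some with any-true⁻ (dominatorᵇ W S x) (allFin n) some
    ...   | s , s-adj = nbr (lookup⇒[]= s S (∧-conicalˡ (lookup S s) _ s-adj))
                            (AdjIn⇒Edge W s x (∧-conicalʳ (lookup S s) _ s-adj))

  Dominated⇒NCl : ∀ {W S x} → Dominated W S x → x ∈ NCl G W S
  Dominated⇒NCl {W} {S} {x} d = lookup⇒[]= x _ (trans (lookup∘tabulate (inNClᵇ W S) x) (holds d))
    where
    holds : Dominated W S x → inNClᵇ W S x ≡ true
    holds (self x∈W x∈S) = ∧-true⁺ ([]=⇒lookup x∈W) (cong (_∨ any (dominatorᵇ W S x) (allFin n)) ([]=⇒lookup x∈S))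
    holds (nbr {s} s∈S e) =
      ∧-true⁺ ([]=⇒lookup (head∈ e))
        (trans (cong (lookup S x ∨_) (any-true⁺ (dominatorᵇ W S x) (∈-allFin s) s-dominates)) (∨-zeroʳ _))
      where
      s-dominates : dominatorᵇ W S x s ≡ true
      s-dominates = ∧-true⁺ ([]=⇒lookup s∈S) (Edge⇒AdjIn e)

  reach-step : ∀ {W u v w} → Reach G W u v → Edge W v w → Reach G W u w
  reach-step r e = step r (Edge⇒AdjIn e)

  reach-edge : ∀ {W u v} → Edge W u v → Reach G W u v
  reach-edge e = reach-step (here (tail∈ e)) e

  reach-ends : ∀ {W u v} → Reach G W u v → u ∈ W × v ∈ W
  reach-ends (here u∈) = u∈ , u∈
  reach-ends {W} (step {v = v} {w} r e) = proj₁ (reach-ends r) , head∈ (AdjIn⇒Edge W v w e)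

  reach-trans : ∀ {W u v w} → Reach G W u v → Reach G W v w → Reach G W u w
  reach-trans r (here _)   = r
  reach-trans r (step r′ e) = step (reach-trans r r′) e

  reach-sym : ∀ {W u v} → Reach G W u v → Reach G W v u
  reach-sym (here u∈) = here u∈
  reach-sym {W} (step {v = v} {w} r e) = reach-trans (reach-edge (Edge-sym (AdjIn⇒Edge W v w e))) (reach-sym r)

  reach-mono : ∀ {W W′ u v} → W ⊆ W′ → Reach G W u v → Reach G W′ u v
  reach-mono W⊆W′ (here u∈) = here (W⊆W′ u∈)
  reach-mono {W} W⊆W′ (step {v = v} {w} r e) = reach-step (reach-mono W⊆W′ r) (Edge-mono W⊆W′ (AdjIn⇒Edge W v w e))

  reach-restrict : ∀ {W B s t} → (∀ {y} → Reach G W s y → y ∈ B) → Reach G W s t → Reach G B s t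
  reach-restrict inB (here s∈) = here (inB (here s∈))
  reach-restrict {W} inB (step {v = v} {w} r e) =
    reach-step (reach-restrict inB r) (edge (inB r) (inB (step r e)) (adj (AdjIn⇒Edge W v w e)))

  Connected : Subset n → Subset n → Set
  Connected W B = ∀ {a b} → a ∈ B → b ∈ B → Reach G W a b

  private
    Extends : Subset n → Subset n → Pred (Fin n) 0ℓ
    Extends W B w = ∃ λ u → u ∈ B × Edge W u w

    Extends? : ∀ W B → Decidable (Extends W B)
    Extends? W B w = any? (λ u → (u ∈? B) ×-dec Edge? W u w)

    module Components (W : Subset n) = Closure (Extends W) (Extends? W)

  component : Subset n → Fin n → Subset n
  component W y = proj₁ (Components.closure W (⁅ y ⁆ ∩ W))

  ∈component⁻ : ∀ {W y z} → z ∈ component W y → Reach G W y z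
  ∈component⁻ {W} {y} =
    Components.IsClosureOf.induct (proj₂ (Components.closure W (⁅ y ⁆ ∩ W))) (Reach G W y) start
      (λ reached (u , u∈ , e) → reach-step (reached u∈) e)
    where
    start : ∀ {x} → x ∈ ⁅ y ⁆ ∩ W → Reach G W y x
    start x∈ with x∈p∩q⁻ ⁅ y ⁆ W x∈
    ... | x∈⁅y⁆ , x∈W rewrite x∈⁅y⁆⇒x≡y y x∈⁅y⁆ = here x∈W

  ∈component⁺ : ∀ {W y z} → Reach G W y z → z ∈ component W y
  ∈component⁺ {W} {y} (here y∈) =
    Components.IsClosureOf.contains (proj₂ (Components.closure W (⁅ y ⁆ ∩ W))) (x∈p∩q⁺ (x∈⁅x⁆ y , y∈))
  ∈component⁺ {W} {y} (step {v = v} {w} r e) =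
    Components.IsClosureOf.closed (proj₂ (Components.closure W (⁅ y ⁆ ∩ W)))
      (v , ∈component⁺ r , AdjIn⇒Edge W v w e)

  component⊆ : ∀ {W y} → component W y ⊆ W
  component⊆ = proj₂ ∘ reach-ends ∘ ∈component⁻

  reach-component : ∀ {W y z} → z ∈ component W y → Reach G (component W y) y z
  reach-component z∈ = reach-restrict ∈component⁺ (∈component⁻ z∈)

  component-trans : ∀ {W y u w} → u ∈ component W y → w ∈ component W u → w ∈ component W y
  component-trans u∈ w∈ = ∈component⁺ (reach-trans (∈component⁻ u∈) (∈component⁻ w∈))

  reach-leave : ∀ {Y v y} → Reach G Y v y → y ≢ v →
                ∃ λ z → z ∈ Y ∖ ⁅ v ⁆ × v ~ z × Reach G (Y ∖ ⁅ v ⁆) z y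
  reach-leave (here _) y≢v = ⊥-elim (y≢v refl)
  reach-leave {Y} {v} (step {v = u} {y} r e) y≢v with AdjIn⇒Edge Y u y e | u ≟ᶠ v
  ... | edge _ y∈ v~y | yes refl = y , x∈p∖⁅y⁆⁺ y∈ y≢v , v~y , here (x∈p∖⁅y⁆⁺ y∈ y≢v)
  ... | edge u∈ y∈ u~y | no u≢v with reach-leave r u≢v
  ...   | z , z∈ , v~z , r′ = z , z∈ , v~z , reach-step r′ (edge (x∈p∖⁅y⁆⁺ u∈ u≢v) (x∈p∖⁅y⁆⁺ y∈ y≢v) u~y)

  reach-in-pair : ∀ {A a b} → ∣ A ∣ ≤ 2 → Reach G A a b → a ≢ b → a ~ b
  reach-in-pair _ (here _) a≢b = ⊥-elim (a≢b refl)
  reach-in-pair {A} {a} ∣A∣≤2 (step {v = u} {b} r e) a≢b with AdjIn⇒Edge A u b e | u ≟ᶠ a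
  ... | edge _ _ a~b   | yes refl = a~b
  ... | edge u∈ b∈ u~b | no u≢a  =
    ⊥-elim (∣p∣≤2⇒¬distinct₃ ∣A∣≤2 u∈ (proj₁ (reach-ends r)) b∈ u≢a (~⇒≢ u~b) a≢b)

  data Forced (W : Subset n) (O : Pred (Fin n) 0ℓ) : Pred (Fin n) 0ℓ where
    observed : ∀ {x} → O x → Forced W O x
    forces   : ∀ {v w} → Forced W O v → Edge W v w →
               (∀ {u} → Edge W v u → u ≢ w → Forced W O u) → Forced W O w

  InPD⇒Forced : ∀ {W S x} → InPD G W S x → Forced W (Dominated W S) x
  InPD⇒Forced {W} {S} (base x∈) = observed (NCl⇒Dominated W S _ x∈)
  InPD⇒Forced {W} (force {v} {w} p e others) =
    forces (InPD⇒Forced p) (AdjIn⇒Edge W v w e) (λ {u} e′ u≢w → InPD⇒Forced (others u (Edge⇒AdjIn e′) u≢w))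

  Forced⇒InPD : ∀ {W S x} → Forced W (Dominated W S) x → InPD G W S x
  Forced⇒InPD (observed d) = base (Dominated⇒NCl d)
  Forced⇒InPD {W} (forces {v} f e others) =
    force (Forced⇒InPD f) (Edge⇒AdjIn e) (λ u e′ u≢w → Forced⇒InPD (others (AdjIn⇒Edge W v u e′) u≢w))

  forced-weaken : ∀ {W O O′} → (∀ {x} → O x → Forced W O′ x) → ∀ {x} → Forced W O x → Forced W O′ x
  forced-weaken O⇒ (observed o) = O⇒ o
  forced-weaken O⇒ (forces f e others) =
    forces (forced-weaken O⇒ f) e (λ e′ u≢w → forced-weaken O⇒ (others e′ u≢w))

  -- A forcing step v → w of G[W] stays valid in G[W′] once the new neighbours of v are observed,
  -- unless w is observed in G[W′] anyway.
  forced-lift : ∀ {W W′ O O′} → W ⊆ W′ → (∀ {x} → O x → Forced W′ O′ x) →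
    (∀ {v w} → Forced W′ O′ v → Edge W v w →
       Forced W′ O′ w ⊎ (∀ {u} → Edge W′ v u → u ∉ W → Forced W′ O′ u)) →
    ∀ {x} → Forced W O x → Forced W′ O′ x
  forced-lift W⊆W′ O⇒ lift-step (observed o) = O⇒ o
  forced-lift {W} {W′} {O} {O′} W⊆W′ O⇒ lift-step (forces {v} {w} f e others) =
    [ id , forced-by-v ]′ (lift-step fv e)
    where
    fv : Forced W′ O′ v
    fv = forced-lift W⊆W′ O⇒ lift-step f

    forced-by-v : (∀ {u} → Edge W′ v u → u ∉ W → Forced W′ O′ u) → Forced W′ O′ w
    forced-by-v new = forces fv (Edge-mono W⊆W′ e) others′
      where
      others′ : ∀ {u} → Edge W′ v u → u ≢ w → Forced W′ O′ u
      others′ {u} e′ u≢w with u ∈? W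
      ... | yes u∈W = forced-lift W⊆W′ O⇒ lift-step (others (edge (tail∈ e) u∈W (adj e′)) u≢w)
      ... | no  u∉W = new e′ u∉W

  private
    ForcedFrom : Subset n → Subset n → Pred (Fin n) 0ℓ
    ForcedFrom W A w = ∃ λ v → v ∈ A × Edge W v w × (∀ u → Edge W v u → u ≢ w → u ∈ A)

    ForcedFrom? : ∀ W A → Decidable (ForcedFrom W A)
    ForcedFrom? W A w = any? λ v → (v ∈? A) ×-dec Edge? W v w ×-dec
                                   all? (λ u → Edge? W v u →-dec ¬? (u ≟ᶠ w) →-dec (u ∈? A))

    module Propagation (W : Subset n) = Closure (ForcedFrom W) (ForcedFrom? W)

  InPD? : ∀ W S x → Dec (InPD G W S x)
  InPD? W S x = map′ (induct (InPD G W S) base forcing) observe (x ∈? PD)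
    where
    PD = proj₁ (Propagation.closure W (NCl G W S))
    open Propagation.IsClosureOf W (proj₂ (Propagation.closure W (NCl G W S)))

    forcing : ∀ {B w} → (∀ {y} → y ∈ B → InPD G W S y) → ForcedFrom W B w → InPD G W S w
    forcing inB (v , v∈ , e , rest) =
      force (inB v∈) (Edge⇒AdjIn e) (λ u e′ u≢w → inB (rest u (AdjIn⇒Edge W v u e′) u≢w))

    observe : ∀ {y} → InPD G W S y → y ∈ PD
    observe (base y∈)              = contains y∈
    observe (force {v} p e others) =
      closed (v , observe p , AdjIn⇒Edge W v _ e , λ u e′ u≢w → observe (others u (Edge⇒AdjIn e′) u≢w))

  IsPDS? : ∀ W S → Dec (IsPDS G W S)
  IsPDS? W S = (S ⊆? W) ×-dec all? (λ v → (v ∈? W) →-dec InPD? W S v)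

  -- γ_P(H) ≤ |H|/3 when all components have at least 3 vertices

  SmallPDS : Subset n → Set
  SmallPDS W = ∃ λ D → IsPDS G W D × 3 * ∣ D ∣ ≤ ∣ W ∣

  -- Removing X leaves forcing in G[W ∖ X] undisturbed and creates no component with < 3 vertices.
  record Piece (W K : Subset n) : Set where
    field
      D X        : Subset n
      D⊆X        : D ⊆ X
      X⊆K        : X ⊆ K
      X-nonempty : Nonempty X
      D-small    : 3 * ∣ D ∣ ≤ ∣ X ∣
      boundary   : ∀ {x u} → x ∈ X → Edge W x u → u ∉ X → Dominated W D x
      X-forced   : ∀ {x} → x ∈ X → Forced W (λ y → Dominated W D y ⊎ y ∈ W ∖ X) x
      remainder  : K ⊆ X ⊎ (3 ≤ ∣ K ∖ X ∣ × Connected (W ∖ X) (K ∖ X))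

  module _ {W K : Subset n} (K⊆W : K ⊆ W) (P : Piece W K) where
    open Piece P

    private
      X⊆W : X ⊆ W
      X⊆W = K⊆W ∘ X⊆K

    ∖piece⊂ : W ∖ X ⊂ W
    ∖piece⊂ = let (x , x∈X) = X-nonempty in p∖q⊆p , x , X⊆W x∈X , λ x∈ → x∈p∖q⇒x∉q x∈ x∈X

    ∖piece-componentsAtLeast3 : (∀ {a b} → a ∈ K → Reach G W a b → b ∈ K) →
      ComponentsAtLeast3 G W → ComponentsAtLeast3 G (W ∖ X)
    ∖piece-componentsAtLeast3 K-closed c3 v v∈ with v ∈? K | remainder
    ... | yes v∈K | inj₁ K⊆X = ⊥-elim (x∈p∖q⇒x∉q v∈ (K⊆X v∈K))
    ... | yes v∈K | inj₂ (3≤∣K∖X∣ , connected) with 3≤∣p∣⇒distinct₃ 3≤∣K∖X∣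
    ...   | a , b , c , a∈ , b∈ , c∈ , a≢b , a≢c , b≢c =
      a , b , c , a≢b , a≢c , b≢c , connected v∈′ a∈ , connected v∈′ b∈ , connected v∈′ c∈
      where v∈′ = x∈p∖q⁺ v∈K (x∈p∖q⇒x∉q v∈)
    ∖piece-componentsAtLeast3 K-closed c3 v v∈ | no v∉K | _ with c3 v (p∖q⊆p v∈)
    ... | a , b , c , a≢b , a≢c , b≢c , ra , rb , rc =
      a , b , c , a≢b , a≢c , b≢c ,
      reach-restrict avoidsX ra , reach-restrict avoidsX rb , reach-restrict avoidsX rc
      where
      avoidsX : ∀ {y} → Reach G W v y → y ∈ W ∖ X
      avoidsX {y} r = x∈p∖q⁺ (proj₂ (reach-ends r)) λ y∈X → v∉K (K-closed (X⊆K y∈X) (reach-sym r))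

    extendPDS : SmallPDS (W ∖ X) → SmallPDS W
    extendPDS (D′ , (D′⊆ , D′-pds) , D′-small) = D ∪ D′ , (D∪D′⊆W , λ y y∈ → Forced⇒InPD (forced y y∈)) , count
      where
      D∪D′⊆W : D ∪ D′ ⊆ W
      D∪D′⊆W x∈ with x∈p∪q⁻ D D′ x∈
      ... | inj₁ x∈D  = X⊆W (D⊆X x∈D)
      ... | inj₂ x∈D′ = p∖q⊆p (D′⊆ x∈D′)

      count : 3 * ∣ D ∪ D′ ∣ ≤ ∣ W ∣
      count = begin
        3 * ∣ D ∪ D′ ∣       ≤⟨ *-monoʳ-≤ 3 (∣p∪q∣≤∣p∣+∣q∣ D D′) ⟩
        3 * (d + d′)         ≡⟨ *-distribˡ-+ 3 d d′ ⟩
        3 * d + 3 * d′       ≤⟨ +-mono-≤ D-small D′-small ⟩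
        ∣ X ∣ + ∣ W ∖ X ∣    ≡⟨ ∣p∣≡∣q∣+∣p∖q∣ X⊆W ⟨
        ∣ W ∣                ∎
        where
        open ≤-Reasoning
        d  = ∣ D ∣
        d′ = ∣ D′ ∣

      Obs : Pred (Fin n) 0ℓ
      Obs = Dominated W (D ∪ D′)

      fromD : ∀ {x} → Dominated W D x → Forced W Obs x
      fromD = observed ∘ Dominated-mono id (p⊆p∪q D′)

      outside : ∀ {x} → x ∈ W ∖ X → Forced W Obs x
      outside x∈ = forced-lift p∖q⊆p (observed ∘ Dominated-mono p∖q⊆p (q⊆p∪q D D′)) lift-step
                     (InPD⇒Forced (D′-pds _ x∈))
        where
        lift-step : ∀ {v w} → Forced W Obs v → Edge (W ∖ X) v w →
                    Forced W Obs w ⊎ (∀ {u} → Edge W v u → u ∉ W ∖ X → Forced W Obs u)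
        lift-step _ e = inj₂ λ {u} e′ u∉ → case u ∈? X of λ where
          (yes u∈X) → fromD (boundary u∈X (Edge-sym e′) (x∈p∖q⇒x∉q (tail∈ e)))
          (no  u∉X) → ⊥-elim (u∉ (x∈p∖q⁺ (head∈ e′) u∉X))

      forced : ∀ y → y ∈ W → Forced W Obs y
      forced y y∈W with y ∈? X
      ... | yes y∈X = forced-weaken [ fromD , outside ]′ (X-forced y∈X)
      ... | no  y∉X = outside (x∈p∖q⁺ y∈W y∉X)

  smallPDS-byPieces : (∀ W x → x ∈ W → ComponentsAtLeast3 G W → Piece W (component W x)) →
                      ∀ W → ComponentsAtLeast3 G W → SmallPDS W
  smallPDS-byPieces piece W = go W (⊂-wellFounded W)
    where
    go : ∀ W → Acc _⊂_ W → ComponentsAtLeast3 G W → SmallPDS W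
    go W (acc rec) c3 with nonempty? W
    ... | no  empty = ⊥ , ((λ x∈ → ⊥-elim (∉⊥ x∈)) , λ x x∈ → ⊥-elim (empty (x , x∈))) ,
                      subst (λ k → 3 * k ≤ ∣ W ∣) (sym (∣⊥∣≡0 n)) z≤n
    ... | yes (x , x∈W) =
      extendPDS component⊆ P (go (W ∖ X) (rec (∖piece⊂ component⊆ P))
        (∖piece-componentsAtLeast3 component⊆ P K-closed c3))
      where
      P = piece W x x∈W c3
      open Piece P using (X)
      K-closed : ∀ {a b} → a ∈ component W x → Reach G W a b → b ∈ component W x
      K-closed a∈ r = ∈component⁺ (reach-trans (∈component⁻ a∈) r)

  module PieceOfComponent (W : Subset n) (x₀ : Fin n) (x₀∈W : x₀ ∈ W) (c3 : ComponentsAtLeast3 G W) where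

    K : Subset n
    K = component W x₀

    K⊆W : K ⊆ W
    K⊆W = component⊆

    K-closed : ∀ {a u} → a ∈ K → Edge W a u → u ∈ K
    K-closed a∈ e = ∈component⁺ (reach-step (∈component⁻ a∈) e)

    3≤∣K∣ : 3 ≤ ∣ K ∣
    3≤∣K∣ with c3 x₀ x₀∈W
    ... | a , b , c , a≢b , a≢c , b≢c , ra , rb , rc =
      distinct⇒3≤∣p∣ (∈component⁺ ra) (∈component⁺ rb) (∈component⁺ rc) a≢b a≢c b≢c

    record Hub (v : Fin n) (Y : Subset n) : Set where
      field
        Y⊆K         : Y ⊆ K
        v∈Y         : v ∈ Y
        3≤∣Y∣       : 3 ≤ ∣ Y ∣
        Y-spanned   : ∀ {y} → y ∈ Y → Reach G Y v y
        R-connected : Connected (K ∖ Y) (K ∖ Y)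
        R-attached  : ∀ {a} → a ∈ K ∖ Y → ∃ λ r → r ∈ K ∖ Y × v ~ r

    SmallBranches : Fin n → Subset n → Set
    SmallBranches v Y = ∀ {z} → z ∈ Y ∖ ⁅ v ⁆ → ∣ component (Y ∖ ⁅ v ⁆) z ∣ ≤ 2

    hub₀ : Hub x₀ K
    hub₀ = record
      { Y⊆K         = id
      ; v∈Y         = ∈component⁺ (here x₀∈W)
      ; 3≤∣Y∣       = 3≤∣K∣
      ; Y-spanned   = reach-component
      ; R-connected = λ a∈ _ → ⊥-elim (x∈p∖q⇒x∉q a∈ (p∖q⊆p a∈))
      ; R-attached  = λ a∈ → ⊥-elim (x∈p∖q⇒x∉q a∈ (p∖q⊆p a∈))
      }

    -- Descend into a big branch Q of Y ∖ v, re-rooted at its neighbour v′ of v; the old hub v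
    -- then connects the new complement K ∖ Q.
    module _ {v Y} (hub : Hub v Y) {z} (z∈ : z ∈ Y ∖ ⁅ v ⁆) (big : 3 ≤ ∣ component (Y ∖ ⁅ v ⁆) z ∣) where
      open Hub hub

      private
        leave = reach-leave (Y-spanned (p∖q⊆p z∈)) (x∈p∖⁅y⁆⇒x≢y z∈)
        v′ = proj₁ leave
        v′∈ : v′ ∈ Y ∖ ⁅ v ⁆
        v′∈ = proj₁ (proj₂ leave)
        v~v′ : v ~ v′
        v~v′ = proj₁ (proj₂ (proj₂ leave))
        Q = component (Y ∖ ⁅ v ⁆) v′

        Q⊆Y : Q ⊆ Y
        Q⊆Y = p∖q⊆p ∘ component⊆

        v∉Q : v ∉ Q
        v∉Q v∈Q = x∈p∖⁅y⁆⇒x≢y (component⊆ v∈Q) refl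

        v∈R′ : v ∈ K ∖ Q
        v∈R′ = x∈p∖q⁺ (Y⊆K v∈Y) v∉Q

        R⊆R′ : K ∖ Y ⊆ K ∖ Q
        R⊆R′ a∈ = x∈p∖q⁺ (p∖q⊆p a∈) (x∈p∖q⇒x∉q a∈ ∘ Q⊆Y)

        reach-v : ∀ {a} → a ∈ K ∖ Q → Reach G (K ∖ Q) a v
        reach-v {a} a∈ with a ∈? Y
        ... | no a∉Y with R-attached (x∈p∖q⁺ (p∖q⊆p a∈) a∉Y)
        ...   | r , r∈ , v~r = reach-step (reach-mono R⊆R′ (R-connected (x∈p∖q⁺ (p∖q⊆p a∈) a∉Y) r∈))
                                         (edge (R⊆R′ r∈) v∈R′ (~-sym v~r))
        reach-v {a} a∈ | yes a∈Y with a ≟ᶠ v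
        ... | yes refl = here a∈
        ... | no a≢v with reach-leave (Y-spanned a∈Y) a≢v
        ...   | b , b∈ , v~b , b→a =
          reach-trans (reach-sym (reach-restrict outsideQ b→a))
                      (reach-edge (edge (outsideQ (here b∈)) v∈R′ (~-sym v~b)))
          where
          outsideQ : ∀ {t} → Reach G (Y ∖ ⁅ v ⁆) b t → t ∈ K ∖ Q
          outsideQ b→t = x∈p∖q⁺ (Y⊆K (p∖q⊆p (proj₂ (reach-ends b→t))))
            λ t∈Q → x∈p∖q⇒x∉q a∈ (component-trans t∈Q (∈component⁺ (reach-trans (reach-sym b→t) b→a)))

      shrink : ∃ λ v′ → ∃ λ Q → Hub v′ Q × Q ⊂ Y
      shrink = v′ , Q , hub′ , Q⊆Y , v , v∈Y , v∉Q
        where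
        hub′ : Hub v′ Q
        hub′ = record
          { Y⊆K         = Y⊆K ∘ Q⊆Y
          ; v∈Y         = ∈component⁺ (here v′∈)
          ; 3≤∣Y∣       = ≤-trans big (p⊆q⇒∣p∣≤∣q∣ (component-trans (∈component⁺ (proj₂ (proj₂ (proj₂ leave))))))
          ; Y-spanned   = reach-component
          ; R-connected = λ a∈ b∈ → reach-trans (reach-v a∈) (reach-sym (reach-v b∈))
          ; R-attached  = λ _ → v , v∈R′ , ~-sym v~v′
          }

    settle : ∀ {v Y} → Acc _⊂_ Y → Hub v Y → ∃ λ v → ∃ λ Y → Hub v Y × SmallBranches v Y
    settle {v} {Y} (acc rec) hub with any? (λ z → (z ∈? Y ∖ ⁅ v ⁆) ×-dec (3 ≤? ∣ component (Y ∖ ⁅ v ⁆) z ∣))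
    ... | no  none = v , Y , hub , λ z∈ → ≤-pred (≰⇒> λ big → none (_ , z∈ , big))
    ... | yes (z , z∈ , big) with shrink hub z∈ big
    ...   | v′ , Q , hub′ , Q⊂Y = settle (rec Q⊂Y) hub′

    componentPiece : ∀ {D} → D ⊆ K → 3 * ∣ D ∣ ≤ ∣ K ∣ → (∀ {x} → x ∈ K → Forced W (Dominated W D) x) → Piece W K
    componentPiece {D} D⊆K D-small K-forced = record
      { D = D ; X = K ; D⊆X = D⊆K ; X⊆K = id
      ; X-nonempty = 1≤∣p∣⇒nonempty (≤-trans (s≤s z≤n) 3≤∣K∣)
      ; D-small    = D-small
      ; boundary   = λ x∈ e u∉K → ⊥-elim (u∉K (K-closed x∈ e))
      ; X-forced   = forced-weaken (observed ∘ inj₁) ∘ K-forced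
      ; remainder  = inj₁ id
      }

    data Among₅ (v a b p q : Fin n) : Pred (Fin n) 0ℓ where
      is-v : Among₅ v a b p q v
      is-a : Among₅ v a b p q a
      is-b : Among₅ v a b p q b
      is-p : Among₅ v a b p q p
      is-q : Among₅ v a b p q q

    -- K = {v, a, b, p, q}: the components left over when R = {p, q} and Y ∖ v = {a, b}.
    module FiveVertices {v a b p q} (listed : ∀ {u} → u ∈ K → Among₅ v a b p q u)
                        (v∈K : v ∈ K) (a∈K : a ∈ K) (b∈K : b ∈ K) (p∈K : p ∈ K) (q∈K : q ∈ K) where

      private
        forcedBy : ∀ {O c x} → c ∈ K → Forced W O c → x ∈ K → c ~ x →
                   (∀ {u} → Among₅ v a b p q u → c ~ u → u ≢ x → Forced W O u) → Forced W O x
        forcedBy c∈ fc x∈ c~x others =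
          forces fc (edge (K⊆W c∈) (K⊆W x∈) c~x) λ e u≢x → others (listed (K-closed c∈ e)) (adj e) u≢x

      -- a forces b (if needed), then p forces q
      forced-from-v : v ~ a → v ~ p → p ~ q → v ~ b ⊎ (a ~ b × ¬ a ~ q) →
                      ∀ {x} → x ∈ K → Forced W (Dominated W ⁅ v ⁆) x
      forced-from-v v~a v~p p~q b-reached = at ∘ listed
        where
        O = Dominated W ⁅ v ⁆

        near : ∀ {u} → u ∈ K → u ≡ v ⊎ v ~ u → Forced W O u
        near u∈ = observed ∘ dominated-by (K⊆W v∈K) (K⊆W u∈)

        b-forced : v ~ b ⊎ (a ~ b × ¬ a ~ q) → Forced W O b
        b-forced (inj₁ v~b)         = near b∈K (inj₂ v~b)
        b-forced (inj₂ (a~b , a≁q)) = forcedBy a∈K (near a∈K (inj₂ v~a)) b∈K a~b others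
          where
          others : ∀ {u} → Among₅ v a b p q u → a ~ u → u ≢ b → Forced W O u
          others is-v _   _   = near v∈K (inj₁ refl)
          others is-a a~a _   = ⊥-elim (~⇒≢ a~a refl)
          others is-b _   b≢b = ⊥-elim (b≢b refl)
          others is-p _   _   = near p∈K (inj₂ v~p)
          others is-q a~q _   = ⊥-elim (a≁q a~q)

        q-forced : Forced W O q
        q-forced = forcedBy p∈K (near p∈K (inj₂ v~p)) q∈K p~q others
          where
          others : ∀ {u} → Among₅ v a b p q u → p ~ u → u ≢ q → Forced W O u
          others is-v _   _   = near v∈K (inj₁ refl)
          others is-a _   _   = near a∈K (inj₂ v~a)
          others is-b _   _   = b-forced b-reached
          others is-p p~p _   = ⊥-elim (~⇒≢ p~p refl)
          others is-q _   q≢q = ⊥-elim (q≢q refl)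

        at : ∀ {x} → Among₅ v a b p q x → Forced W O x
        at is-v = near v∈K (inj₁ refl)
        at is-a = near a∈K (inj₂ v~a)
        at is-b = b-forced b-reached
        at is-p = near p∈K (inj₂ v~p)
        at is-q = q-forced

      -- v forces p
      forced-from-a : v ~ a → a ~ b → a ~ q → v ~ p → ¬ v ~ b → ¬ v ~ q →
                      ∀ {x} → x ∈ K → Forced W (Dominated W ⁅ a ⁆) x
      forced-from-a v~a a~b a~q v~p v≁b v≁q = at ∘ listed
        where
        O = Dominated W ⁅ a ⁆

        near : ∀ {u} → u ∈ K → u ≡ a ⊎ a ~ u → Forced W O u
        near u∈ = observed ∘ dominated-by (K⊆W a∈K) (K⊆W u∈)

        others : ∀ {u} → Among₅ v a b p q u → v ~ u → u ≢ p → Forced W O u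
        others is-v v~v _   = ⊥-elim (~⇒≢ v~v refl)
        others is-a _   _   = near a∈K (inj₁ refl)
        others is-b v~b _   = ⊥-elim (v≁b v~b)
        others is-p _   p≢p = ⊥-elim (p≢p refl)
        others is-q v~q _   = ⊥-elim (v≁q v~q)

        at : ∀ {x} → Among₅ v a b p q x → Forced W O x
        at is-v = near v∈K (inj₂ (~-sym v~a))
        at is-a = near a∈K (inj₁ refl)
        at is-b = near b∈K (inj₂ a~b)
        at is-p = forcedBy v∈K (near v∈K (inj₂ (~-sym v~a))) p∈K v~p others
        at is-q = near q∈K (inj₂ a~q)

    module Endgame {v Y} (hub : Hub v Y) (small : SmallBranches v Y) where
      open Hub hub

      R Y⁻ : Subset n
      R  = K ∖ Y
      Y⁻ = Y ∖ ⁅ v ⁆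

      branch : Fin n → Subset n
      branch = component Y⁻

      Y⊆W : Y ⊆ W
      Y⊆W = K⊆W ∘ Y⊆K

      R⊆W : R ⊆ W
      R⊆W = K⊆W ∘ p∖q⊆p

      v∈W : v ∈ W
      v∈W = Y⊆W v∈Y

      ∉R⇒∈Y : ∀ {a} → a ∈ K → a ∉ R → a ∈ Y
      ∉R⇒∈Y {a} a∈K a∉R with a ∈? Y
      ... | yes a∈Y = a∈Y
      ... | no  a∉Y = ⊥-elim (a∉R (x∈p∖q⁺ a∈K a∉Y))

      root : ∀ {y} → y ∈ Y⁻ → ∃ λ c → c ∈ Y⁻ × v ~ c × y ∈ branch c
      root y∈ with reach-leave (Y-spanned (p∖q⊆p y∈)) (x∈p∖⁅y⁆⇒x≢y y∈)
      ... | c , c∈ , v~c , c→y = c , c∈ , v~c , ∈component⁺ c→y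

      root-adj : ∀ {c y} → c ∈ Y⁻ → y ∈ branch c → y ≢ c → c ~ y
      root-adj c∈ y∈ y≢c = reach-in-pair (small c∈) (reach-component y∈) (y≢c ∘ sym)

      branch-≤2 : ∀ {c a b d} → c ∈ Y⁻ → a ∈ branch c → b ∈ branch c → d ∈ branch c →
                  a ≢ b → a ≢ d → b ≢ d → Data.Empty.⊥
      branch-≤2 c∈ = ∣p∣≤2⇒¬distinct₃ (small c∈)

      neighbour-cases : ∀ {c u} → c ∈ Y⁻ → Edge W c u → u ≡ v ⊎ u ∈ branch c ⊎ u ∈ R
      neighbour-cases {c} {u} c∈ e with u ∈? Y
      ... | no u∉Y = inj₂ (inj₂ (x∈p∖q⁺ (K-closed (Y⊆K (p∖q⊆p c∈)) e) u∉Y))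
      ... | yes u∈Y with u ≟ᶠ v
      ...   | yes u≡v = inj₁ u≡v
      ...   | no  u≢v = inj₂ (inj₁ (∈component⁺ (reach-edge (edge c∈ (x∈p∖⁅y⁆⁺ u∈Y u≢v) (adj e)))))

      -- A branch vertex off N[v] is forced by the root of its branch, whose other neighbours
      -- are v, vertices of R, and nothing else since the branch has at most two vertices.
      Y-forced : ∀ {O} → (∀ {u} → u ∈ W → u ≡ v ⊎ v ~ u → O u) → (∀ {r} → r ∈ R → O r) →
                 ∀ {x} → x ∈ Y → Forced W O x
      Y-forced {O} near R-obs {x} x∈Y with x ≟ᶠ v
      ... | yes refl = observed (near v∈W (inj₁ refl))
      ... | no  x≢v with v ~? x
      ...   | yes v~x = observed (near (Y⊆W x∈Y) (inj₂ v~x))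
      ...   | no  v≁x with root (x∈p∖⁅y⁆⁺ x∈Y x≢v)
      ...     | c , c∈ , v~c , x∈bc =
        forces (observed (near c∈W (inj₂ v~c))) (edge c∈W (Y⊆W x∈Y) (root-adj c∈ x∈bc x≢c)) others
        where
        c∈W : c ∈ W
        c∈W = Y⊆W (p∖q⊆p c∈)
        x≢c : x ≢ c
        x≢c refl = v≁x v~c
        others : ∀ {u} → Edge W c u → u ≢ x → Forced W O u
        others e u≢x with neighbour-cases c∈ e
        ... | inj₁ refl        = observed (near v∈W (inj₁ refl))
        ... | inj₂ (inj₂ u∈R)  = observed (R-obs u∈R)
        ... | inj₂ (inj₁ u∈bc) =
          ⊥-elim (branch-≤2 c∈ (∈component⁺ (here c∈)) x∈bc u∈bc (x≢c ∘ sym) (~⇒≢ (adj e)) (u≢x ∘ sym))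

      2≤∣Y⁻∣ : 2 ≤ ∣ Y⁻ ∣
      2≤∣Y⁻∣ = ≤-pred (subst (3 ≤_) (∣p∣≡1+∣p∖⁅x⁆∣ v∈Y) 3≤∣Y∣)

      remainder-via-R : ∀ {X} → X ⊆ Y → Empty R ⊎ 3 ≤ ∣ R ∣ →
        (∀ {a} → a ∈ K ∖ X → a ∉ R → ∃ λ r → r ∈ R × a ~ r) →
        K ⊆ X ⊎ (3 ≤ ∣ K ∖ X ∣ × Connected (W ∖ X) (K ∖ X))
      remainder-via-R {X} X⊆Y shape attached with shape
      ... | inj₁ R-empty = inj₁ K⊆X
        where
        K⊆X : K ⊆ X
        K⊆X {a} a∈K with a ∈? X | a ∈? R
        ... | yes a∈X | _       = a∈X
        ... | no  _   | yes a∈R = ⊥-elim (R-empty (a , a∈R))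
        ... | no  a∉X | no  a∉R = ⊥-elim (R-empty (let (r , r∈R , _) = attached (x∈p∖q⁺ a∈K a∉X) a∉R in r , r∈R))
      ... | inj₂ 3≤∣R∣ =
        inj₂ (≤-trans 3≤∣R∣ (p⊆q⇒∣p∣≤∣q∣ R⊆K∖X) , λ a∈ b∈ → reach-trans (to-r₀ a∈) (reach-sym (to-r₀ b∈)))
        where
        R⊆K∖X : R ⊆ K ∖ X
        R⊆K∖X r∈ = x∈p∖q⁺ (p∖q⊆p r∈) (x∈p∖q⇒x∉q r∈ ∘ X⊆Y)
        R⊆W∖X : R ⊆ W ∖ X
        R⊆W∖X r∈ = x∈p∖q⁺ (R⊆W r∈) (x∈p∖q⇒x∉q (R⊆K∖X r∈))
        r₀ = proj₁ (1≤∣p∣⇒nonempty (≤-trans (s≤s z≤n) 3≤∣R∣))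
        r₀∈ = proj₂ (1≤∣p∣⇒nonempty (≤-trans (s≤s z≤n) 3≤∣R∣))
        to-r₀ : ∀ {a} → a ∈ K ∖ X → Reach G (W ∖ X) a r₀
        to-r₀ {a} a∈ with a ∈? R
        ... | yes a∈R = reach-mono R⊆W∖X (R-connected a∈R r₀∈)
        ... | no  a∉R with attached a∈ a∉R
        ...   | r , r∈R , a~r =
          reach-trans (reach-edge (edge (x∈p∖q⁺ (K⊆W (p∖q⊆p a∈)) (x∈p∖q⇒x∉q a∈)) (R⊆W∖X r∈R) a~r))
                      (reach-mono R⊆W∖X (R-connected r∈R r₀∈))

      -- A branch vertex off N[v] with a neighbour in R cannot be forced before R is observed,
      -- so it is left to the remainder.
      Exposed : Pred (Fin n) 0ℓ
      Exposed c = c ∈ Y⁻ × ¬ v ~ c × ∃ λ r → r ∈ R × c ~ r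

      Exposed? : Decidable Exposed
      Exposed? c = (c ∈? Y⁻) ×-dec ¬? (v ~? c) ×-dec any? (λ r → (r ∈? R) ×-dec (c ~? r))

      X₁ : Subset n
      X₁ = Y ∖ subsetOf Exposed?

      X₁-hub : ∀ {c} → c ∈ Y → (c ≡ v ⊎ v ~ c) → c ∈ X₁
      X₁-hub c∈Y near = x∈p∖q⁺ c∈Y λ c∈E → case near , ∈-subsetOf⁻ Exposed? c∈E of λ where
        (inj₁ refl , c∈Y⁻ , _)  → x∈p∖⁅y⁆⇒x≢y c∈Y⁻ refl
        (inj₂ v~c  , _ , v≁c , _) → v≁c v~c

      ∉X₁⇒Exposed : ∀ {c} → c ∈ Y → c ∉ X₁ → Exposed c
      ∉X₁⇒Exposed {c} c∈Y c∉X₁ with Exposed? c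
      ... | yes exposed = exposed
      ... | no  covered = ⊥-elim (c∉X₁ (x∈p∖q⁺ c∈Y (covered ∘ ∈-subsetOf⁻ Exposed?)))

      hubPiece : Empty R ⊎ 3 ≤ ∣ R ∣ → 3 ≤ ∣ X₁ ∣ → Piece W K
      hubPiece shape 3≤∣X₁∣ = record
        { D = ⁅ v ⁆ ; X = X₁ ; D⊆X = x∈p⇒⁅x⁆⊆p (X₁-hub v∈Y (inj₁ refl)) ; X⊆K = Y⊆K ∘ p∖q⊆p
        ; X-nonempty = 1≤∣p∣⇒nonempty (≤-trans (s≤s z≤n) 3≤∣X₁∣)
        ; D-small    = 3*∣⁅x⁆∣≤∣p∣ {p = X₁} v 3≤∣X₁∣
        ; boundary   = boundary
        ; X-forced   = Y-forced (λ u∈ near → inj₁ (dominated-by v∈W u∈ near))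
                                (λ r∈R → inj₂ (x∈p∖q⁺ (R⊆W r∈R) (x∈p∖q⇒x∉q r∈R ∘ p∖q⊆p))) ∘ p∖q⊆p
        ; remainder  = remainder-via-R p∖q⊆p shape λ {a} a∈ a∉R →
                         proj₂ (proj₂ (∉X₁⇒Exposed (∉R⇒∈Y (p∖q⊆p a∈) a∉R) (x∈p∖q⇒x∉q a∈)))
        }
        where
        boundary : ∀ {x u} → x ∈ X₁ → Edge W x u → u ∉ X₁ → Dominated W ⁅ v ⁆ x
        boundary {x} {u} x∈ e u∉X₁ with x ≟ᶠ v | v ~? x
        ... | yes refl | _       = dominated-by v∈W v∈W (inj₁ refl)
        ... | no  _    | yes v~x = dominated-by v∈W (tail∈ e) (inj₂ v~x)
        ... | no  x≢v  | no  v≁x with u ∈? Y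
        ...   | no  u∉Y = ⊥-elim (x∈p∖q⇒x∉q x∈ (∈-subsetOf⁺ Exposed? (x∈Y⁻ , v≁x , u , u∈R , adj e)))
          where
          x∈Y⁻ = x∈p∖⁅y⁆⁺ (p∖q⊆p x∈) x≢v
          u∈R  = x∈p∖q⁺ (K-closed (Y⊆K (p∖q⊆p x∈)) e) u∉Y
        ...   | yes u∈Y with ∉X₁⇒Exposed u∈Y u∉X₁ | root (x∈p∖⁅y⁆⁺ (p∖q⊆p x∈) x≢v)
        ...     | u∈Y⁻ , v≁u , _ | c , c∈ , v~c , x∈bc =
          ⊥-elim (branch-≤2 c∈ (∈component⁺ (here c∈)) x∈bc u∈bc
                    (λ c≡x → v≁x (subst (v ~_) c≡x v~c)) (λ c≡u → v≁u (subst (v ~_) c≡u v~c)) (~⇒≢ (adj e)))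
          where
          u∈bc = component-trans x∈bc (∈component⁺ (reach-edge (edge (x∈p∖⁅y⁆⁺ (p∖q⊆p x∈) x≢v) u∈Y⁻ (adj e))))

      -- v and the branch roots are unexposed, so |X₁| ≤ 2 leaves a single branch, and Y ⊆ N[c]
      -- for its root c.
      rootPiece : Empty R ⊎ 3 ≤ ∣ R ∣ → ∣ X₁ ∣ ≤ 2 → Piece W K
      rootPiece shape ∣X₁∣≤2 with 1≤∣p∣⇒nonempty (≤-trans (s≤s z≤n) 2≤∣Y⁻∣)
      ... | y , y∈Y⁻ with root y∈Y⁻
      ... | c , c∈ , v~c , _ = record
        { D = ⁅ c ⁆ ; X = Y ; D⊆X = x∈p⇒⁅x⁆⊆p (p∖q⊆p c∈) ; X⊆K = Y⊆K
        ; X-nonempty = v , v∈Y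
        ; D-small    = 3*∣⁅x⁆∣≤∣p∣ {p = Y} c 3≤∣Y∣
        ; boundary   = λ x∈ _ _ → dominated-by c∈W (Y⊆W x∈) (near-c x∈)
        ; X-forced   = λ x∈ → observed (inj₁ (dominated-by c∈W (Y⊆W x∈) (near-c x∈)))
        ; remainder  = remainder-via-R id shape λ a∈R a∉R → ⊥-elim (a∉R a∈R)
        }
        where
        c∈W = Y⊆W (p∖q⊆p c∈)
        near-c : ∀ {y} → y ∈ Y → y ≡ c ⊎ c ~ y
        near-c {y} y∈Y with y ≟ᶠ v
        ... | yes refl = inj₂ (~-sym v~c)
        ... | no  y≢v with y ≟ᶠ c
        ...   | yes y≡c = inj₁ y≡c
        ...   | no  y≢c with y ∈? branch c | root (x∈p∖⁅y⁆⁺ y∈Y y≢v)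
        ...     | yes y∈bc | _ = inj₂ (root-adj c∈ y∈bc y≢c)
        ...     | no  y∉bc | c′ , c′∈ , v~c′ , y∈bc′ =
          ⊥-elim (∣p∣≤2⇒¬distinct₃ ∣X₁∣≤2
                    (X₁-hub v∈Y (inj₁ refl)) (X₁-hub (p∖q⊆p c∈) (inj₂ v~c)) (X₁-hub (p∖q⊆p c′∈) (inj₂ v~c′))
                    (λ v≡c → x∈p∖⁅y⁆⇒x≢y c∈ (sym v≡c)) (λ v≡c′ → x∈p∖⁅y⁆⇒x≢y c′∈ (sym v≡c′))
                    (λ c≡c′ → y∉bc (subst (λ d → y ∈ branch d) (sym c≡c′) y∈bc′)))

      pieceInsideY : Empty R ⊎ 3 ≤ ∣ R ∣ → Piece W K
      pieceInsideY shape with 3 ≤? ∣ X₁ ∣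
      ... | yes 3≤∣X₁∣ = hubPiece shape 3≤∣X₁∣
      ... | no  3≰∣X₁∣ = rootPiece shape (≤-pred (≰⇒> 3≰∣X₁∣))

      K-forced : ∀ {D} → v ∈ D → (∀ {r} → r ∈ R → Dominated W D r) → ∀ {x} → x ∈ K → Forced W (Dominated W D) x
      K-forced v∈D R-dominated {x} x∈K with x ∈? Y
      ... | yes x∈Y = Y-forced (λ u∈ near → Dominated-mono id (x∈p⇒⁅x⁆⊆p v∈D) (dominated-by v∈W u∈ near))
                               R-dominated x∈Y
      ... | no  x∉Y = observed (R-dominated (x∈p∖q⁺ x∈K x∉Y))

      dominatedByHub : (∀ {r} → r ∈ R → v ~ r) → Piece W K
      dominatedByHub R⊆N[v] = componentPiece (x∈p⇒⁅x⁆⊆p (Y⊆K v∈Y)) (3*∣⁅x⁆∣≤∣p∣ {p = K} v 3≤∣K∣)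
                         (K-forced (x∈⁅x⁆ v) λ r∈R → dominated-by v∈W (R⊆W r∈R) (inj₂ (R⊆N[v] r∈R)))

      module _ {p q} (p∈R : p ∈ R) (q∈R : q ∈ R) (v~p : v ~ p) (p~q : p ~ q) (v≁q : ¬ v ~ q) (∣K∣≤5 : ∣ K ∣ ≤ 5)
               (R-listed : ∀ {r} → r ∈ R → r ≡ p ⊎ r ≡ q) where

        private
          ∣Y⁻∣≤2 : ∣ Y⁻ ∣ ≤ 2
          ∣Y⁻∣≤2 = +-cancelʳ-≤ 2 ∣ Y⁻ ∣ 2 (≤-pred (≤-trans (+-monoʳ-≤ (suc ∣ Y⁻ ∣) 2≤∣R∣) ∣Y∣+∣R∣≤5))
            where
            2≤∣R∣ = distinct⇒2≤∣p∣ p∈R q∈R (λ p≡q → v≁q (subst (v ~_) p≡q v~p))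
            ∣Y∣+∣R∣≤5 : suc ∣ Y⁻ ∣ + ∣ R ∣ ≤ 5
            ∣Y∣+∣R∣≤5 = subst (_≤ 5) (trans (∣p∣≡∣q∣+∣p∖q∣ Y⊆K) (cong (_+ ∣ R ∣) (∣p∣≡1+∣p∖⁅x⁆∣ v∈Y))) ∣K∣≤5

        module _ {a b} (a∈ : a ∈ Y⁻) (b∈ : b ∈ Y⁻) (Y⁻-listed : ∀ {y} → y ∈ Y⁻ → y ≡ a ⊎ y ≡ b) where

          private
            listed : ∀ {u} → u ∈ K → Among₅ v a b p q u
            listed {u} u∈K with u ∈? R
            ... | yes u∈R = [ (λ { refl → is-p }) , (λ { refl → is-q }) ]′ (R-listed u∈R)
            ... | no  u∉R with u ≟ᶠ v
            ...   | yes refl = is-v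
            ...   | no  u≢v  =
              [ (λ { refl → is-a }) , (λ { refl → is-b }) ]′ (Y⁻-listed (x∈p∖⁅y⁆⁺ (∉R⇒∈Y u∈K u∉R) u≢v))

            a∈K = Y⊆K (p∖q⊆p a∈)

            open FiveVertices listed (Y⊆K v∈Y) a∈K (Y⊆K (p∖q⊆p b∈)) (p∖q⊆p p∈R) (p∖q⊆p q∈R)

            dominatedFrom : ∀ {d} → d ∈ K → (∀ {x} → x ∈ K → Forced W (Dominated W ⁅ d ⁆) x) → Piece W K
            dominatedFrom {d} d∈K = componentPiece (x∈p⇒⁅x⁆⊆p d∈K) (3*∣⁅x⁆∣≤∣p∣ {p = K} d 3≤∣K∣)

          fivePiece : (v ~ b → v ~ a) → Piece W K
          fivePiece oriented with v ~? b
          ... | yes v~b = dominatedFrom (Y⊆K v∈Y) (forced-from-v (oriented v~b) v~p p~q (inj₁ v~b))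
          ... | no  v≁b with root b∈
          ...   | c , c∈ , v~c , b∈bc with Y⁻-listed c∈
          ...     | inj₂ refl = ⊥-elim (v≁b v~c)
          ...     | inj₁ refl with root-adj c∈ b∈bc (λ b≡a → v≁b (subst (v ~_) (sym b≡a) v~c)) | a ~? q
          ...       | a~b | yes a~q = dominatedFrom a∈K (forced-from-a v~c a~b a~q v~p v≁b v≁q)
          ...       | a~b | no  a≁q = dominatedFrom (Y⊆K v∈Y) (forced-from-v v~c v~p p~q (inj₂ (a~b , a≁q)))

        fiveCase : Piece W K
        fiveCase with 2≤∣p∣⇒distinct₂ 2≤∣Y⁻∣
        ... | a , b , a∈ , b∈ , a≢b = orient (v ~? a)
          where
          Y⁻-listed : ∀ {y} → y ∈ Y⁻ → y ≡ a ⊎ y ≡ b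
          Y⁻-listed {y} y∈ with y ≟ᶠ a | y ≟ᶠ b
          ... | yes y≡a | _       = inj₁ y≡a
          ... | no  _   | yes y≡b = inj₂ y≡b
          ... | no  y≢a | no  y≢b = ⊥-elim (∣p∣≤2⇒¬distinct₃ ∣Y⁻∣≤2 a∈ b∈ y∈ a≢b (y≢a ∘ sym) (y≢b ∘ sym))

          orient : Dec (v ~ a) → Piece W K
          orient (yes v~a) = fivePiece a∈ b∈ Y⁻-listed (λ _ → v~a)
          orient (no  v≁a) = fivePiece b∈ a∈ (Sum.swap ∘ Y⁻-listed) (⊥-elim ∘ v≁a)

      wholeComponent : ∀ {p} → p ∈ R → v ~ p → ∣ R ∣ ≤ 2 → Piece W K
      wholeComponent {p} p∈R v~p ∣R∣≤2 with any? (λ q → (q ∈? R) ×-dec ¬? (q ≟ᶠ p))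
      ... | no  only-p = dominatedByHub λ r∈R → subst (v ~_) (sym (only-p⇒≡ r∈R)) v~p
        where
        only-p⇒≡ : ∀ {r} → r ∈ R → r ≡ p
        only-p⇒≡ {r} r∈R with r ≟ᶠ p
        ... | yes r≡p = r≡p
        ... | no  r≢p = ⊥-elim (only-p (r , r∈R , r≢p))
      ... | yes (q , q∈R , q≢p) = pairCase (6 ≤? ∣ K ∣) (v ~? q)
        where
        p~q : p ~ q
        p~q = reach-in-pair ∣R∣≤2 (R-connected p∈R q∈R) (q≢p ∘ sym)

        R-listed : ∀ {r} → r ∈ R → r ≡ p ⊎ r ≡ q
        R-listed {r} r∈R with r ≟ᶠ p | r ≟ᶠ q
        ... | yes r≡p | _       = inj₁ r≡p
        ... | no  _   | yes r≡q = inj₂ r≡q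
        ... | no  r≢p | no  r≢q = ⊥-elim (∣p∣≤2⇒¬distinct₃ ∣R∣≤2 p∈R q∈R r∈R (q≢p ∘ sym) (r≢p ∘ sym) (r≢q ∘ sym))

        D : Subset n
        D = ⁅ v ⁆ ∪ ⁅ p ⁆

        D⊆K : D ⊆ K
        D⊆K d∈ = [ x∈p⇒⁅x⁆⊆p (Y⊆K v∈Y) , x∈p⇒⁅x⁆⊆p (p∖q⊆p p∈R) ]′ (x∈p∪q⁻ ⁅ v ⁆ ⁅ p ⁆ d∈)

        ∣D∣≤2 : ∣ D ∣ ≤ 2
        ∣D∣≤2 = ≤-trans (∣p∪q∣≤∣p∣+∣q∣ ⁅ v ⁆ ⁅ p ⁆) (≤-reflexive (cong₂ _+_ (∣⁅x⁆∣≡1 v) (∣⁅x⁆∣≡1 p)))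

        p∈D : p ∈ D
        p∈D = x∈p∪q⁺ (inj₂ (x∈⁅x⁆ p))

        R-dominated : ∀ {r} → r ∈ R → Dominated W D r
        R-dominated r∈R with R-listed r∈R
        ... | inj₁ refl = self (R⊆W r∈R) p∈D
        ... | inj₂ refl = nbr p∈D (edge (R⊆W p∈R) (R⊆W r∈R) p~q)

        pairCase : Dec (6 ≤ ∣ K ∣) → Dec (v ~ q) → Piece W K
        pairCase (yes 6≤∣K∣) _ =
          componentPiece D⊆K (≤-trans (*-monoʳ-≤ 3 ∣D∣≤2) 6≤∣K∣) (K-forced (x∈p∪q⁺ (inj₁ (x∈⁅x⁆ v))) R-dominated)
        pairCase (no _) (yes v~q) =
          dominatedByHub λ r∈R → [ (λ { refl → v~p }) , (λ { refl → v~q }) ]′ (R-listed r∈R)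
        pairCase (no 6≰∣K∣) (no v≁q) = fiveCase p∈R q∈R v~p p~q v≁q (≤-pred (≰⇒> 6≰∣K∣)) R-listed

      endgame : Piece W K
      endgame with nonempty? R
      ... | no  R-empty = pieceInsideY (inj₁ R-empty)
      ... | yes (a , a∈R) with 3 ≤? ∣ R ∣
      ...   | yes 3≤∣R∣ = pieceInsideY (inj₂ 3≤∣R∣)
      ...   | no  3≰∣R∣ with R-attached a∈R
      ...     | p , p∈R , v~p = wholeComponent p∈R v~p (≤-pred (≰⇒> 3≰∣R∣))

    piece : Piece W K
    piece with settle (⊂-wellFounded K) hub₀
    ... | v , Y , hub , small = Endgame.endgame hub small

  smallPDS : ∀ W → ComponentsAtLeast3 G W → SmallPDS W
  smallPDS = smallPDS-byPieces PieceOfComponent.piece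

  -- From G[V] and G′[V′ ∖ V] to G′

  pds-glue : ∀ {V S D} → IsPDS G V S → IsPDS G (∁ V) D → IsPDS G ⊤ (S ∪ Boundary G V S ∪ D)
  pds-glue {V} {S} {D} (_ , S-pds) (_ , D-pds) = (λ _ → ∈⊤) , λ x _ → Forced⇒InPD (everywhere x)
    where
    B T : Subset n
    B = Boundary G V S
    T = S ∪ B ∪ D

    O : Pred (Fin n) 0ℓ
    O = Dominated ⊤ T

    from-S : ∀ {x} → Dominated V S x → Forced ⊤ O x
    from-S = observed ∘ Dominated-mono (λ _ → ∈⊤) (p⊆p∪q _)

    from-D : ∀ {x} → Dominated (∁ V) D x → Forced ⊤ O x
    from-D = observed ∘ Dominated-mono (λ _ → ∈⊤) (q⊆p∪q S _ ∘ q⊆p∪q B D)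

    outside : ∀ {x} → x ∈ ∁ V → Forced ⊤ O x
    outside x∈ = forced-lift (λ _ → ∈⊤) from-D lift-step (InPD⇒Forced (D-pds _ x∈))
      where
      lift-step : ∀ {v w} → Forced ⊤ O v → Edge (∁ V) v w →
                  Forced ⊤ O w ⊎ (∀ {u} → Edge ⊤ v u → u ∉ ∁ V → Forced ⊤ O u)
      lift-step {v} _ e with v ∈? B
      ... | yes v∈B = inj₁ (observed (nbr (q⊆p∪q S _ (p⊆p∪q D v∈B)) (edge ∈⊤ ∈⊤ (adj e))))
      ... | no  v∉B = inj₂ λ {u} e′ u∉∁V → case u ∈? NCl G V S of λ where
        (yes u∈N) → from-S (NCl⇒Dominated V S u u∈N)
        (no  u∉N) → ⊥-elim (v∉B (x∈p∩q⁺
          ( Dominated⇒NCl (nbr (x∈p∧x∉q⇒x∈p─q (x∉∁p⇒x∈p u∉∁V) u∉N) (Edge-sym e′))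
          , tail∈ e)))

    inside : ∀ {x} → x ∈ V → Forced ⊤ O x
    inside x∈ = forced-lift (λ _ → ∈⊤) from-S (λ _ _ → inj₂ λ _ u∉V → outside (x∉p⇒x∈∁p u∉V))
                  (InPD⇒Forced (S-pds _ x∈))

    everywhere : ∀ x → Forced ⊤ O x
    everywhere x with x ∈? V
    ... | yes x∈V = inside x∈V
    ... | no  x∉V = outside (x∉p⇒x∈∁p x∉V)

  γP-upperBound : ∀ V S → Setting G V S → ∃ λ k → IsGammaP G ⊤ S k × 3 * k ≤ ThreeBound G V S
  γP-upperBound V S (_ , S-pds , c3) with smallPDS (∁ V) c3
  ... | D , D-pds , D-small
    with minimumSize (λ U → (S ⊆? U) ×-dec IsPDS? ⊤ U) _ (p⊆p∪q _ , pds-glue S-pds D-pds)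
  ... | k , (T , (S⊆T , T-pds) , ∣T∣≡k) , minimal =
    k , ((T , S⊆T , T-pds , ∣T∣≡k) , λ U S⊆U U-pds → minimal U (S⊆U , U-pds)) , bound
    where
    B = Boundary G V S
    bound : 3 * k ≤ ThreeBound G V S
    bound = begin
      3 * k                     ≤⟨ *-monoʳ-≤ 3 (minimal _ (p⊆p∪q _ , pds-glue S-pds D-pds)) ⟩
      3 * ∣ S ∪ (B ∪ D) ∣       ≤⟨ *-monoʳ-≤ 3 (≤-trans (∣p∪q∣≤∣p∣+∣q∣ S _) (+-monoʳ-≤ s (∣p∪q∣≤∣p∣+∣q∣ B D))) ⟩
      3 * (s + (b + d))         ≡⟨ redistribute s b d ⟩
      3 * s + 3 * d + 3 * b     ≤⟨ +-monoˡ-≤ (3 * b) (+-monoʳ-≤ (3 * s) D-small) ⟩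
      3 * s + ∣ ∁ V ∣ + 3 * b   ∎
      where
      open ≤-Reasoning
      open +-*-Solver
      s = ∣ S ∣
      b = ∣ B ∣
      d = ∣ D ∣
      redistribute : ∀ s b d → 3 * (s + (b + d)) ≡ 3 * s + 3 * d + 3 * b
      redistribute = solve 3 (λ s b d → con 3 :* (s :+ (b :+ d)) := con 3 :* s :+ con 3 :* d :+ con 3 :* b) refl

module TightExample where

  v₀ v₁ v₂ v₃ : Fin 4
  v₀ = zero
  v₁ = suc zero
  v₂ = suc (suc zero)
  v₃ = suc (suc (suc zero))

  arc : Fin 4 → Fin 4 → Bool
  arc (suc zero)       (suc (suc zero))       = true
  arc (suc (suc zero)) (suc (suc (suc zero))) = true
  arc _                _                      = false

  P : Graph 4
  P = record
    { Adj    = λ u v → arc u v ∨ arc v u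
    ; sym    = λ u v → ∨-comm (arc u v) (arc v u)
    ; irrefl = λ { zero → refl ; (suc zero) → refl ; (suc (suc zero)) → refl ; (suc (suc (suc zero))) → refl }
    }

  V : Subset 4
  V = ⁅ v₀ ⁆

  v₀-isolated : ∀ x → Adj P v₀ x ≢ true
  v₀-isolated zero                   ()
  v₀-isolated (suc zero)             ()
  v₀-isolated (suc (suc zero))       ()
  v₀-isolated (suc (suc (suc zero))) ()

  path-connected : ∀ {x} → x ∈ ∁ V → Reach P (∁ V) v₁ x
  path-connected {suc zero}             x∈ = here x∈
  path-connected {suc (suc zero)}       x∈ = reach-edge P (edge (there here) x∈ refl)
  path-connected {suc (suc (suc zero))} x∈ =
    reach-trans P (path-connected (there (there here))) (reach-edge P (edge (there (there here)) x∈ refl))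

  setting : Setting P V V
  setting = (v₁ , λ { (there ()) }) , (id , λ x x∈ → base (Dominated⇒NCl P (self x∈ x∈))) , components
    where
    components : ComponentsAtLeast3 P (∁ V)
    components v v∈ = v₁ , v₂ , v₃ , (λ ()) , (λ ()) , (λ ()) ,
                      from (there here) , from (there (there here)) , from (there (there (there here)))
      where
      from : ∀ {x} → x ∈ ∁ V → Reach P (∁ V) v x
      from x∈ = reach-trans P (reach-sym P (path-connected v∈)) (path-connected x∈)

  T : Subset 4
  T = true ∷ false ∷ true ∷ false ∷ []

  T-pds : IsPDS P ⊤ T
  T-pds = (λ _ → ∈⊤) , λ x _ → base (Dominated⇒NCl P (dominated x))
    where
    dominated : ∀ x → Dominated P ⊤ T x
    dominated zero                   = self ∈⊤ here
    dominated (suc zero)             = nbr (there (there here)) (edge ∈⊤ ∈⊤ refl)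
    dominated (suc (suc zero))       = self ∈⊤ (there (there here))
    dominated (suc (suc (suc zero))) = nbr (there (there here)) (edge ∈⊤ ∈⊤ refl)

  observes-only-v₀ : ∀ {U x} → U ⊆ V → Forced P ⊤ (Dominated P ⊤ U) x → x ≡ v₀
  observes-only-v₀ U⊆V (observed (self _ x∈U)) = x∈⁅y⁆⇒x≡y v₀ (U⊆V x∈U)
  observes-only-v₀ U⊆V (observed (nbr s∈U e)) with x∈⁅y⁆⇒x≡y v₀ (U⊆V s∈U)
  ... | refl = ⊥-elim (v₀-isolated _ (adj e))
  observes-only-v₀ U⊆V (forces f e _) with observes-only-v₀ U⊆V f
  ... | refl = ⊥-elim (v₀-isolated _ (adj e))

  two-needed : ∀ U → V ⊆ U → IsPDS P ⊤ U → 2 ≤ ∣ U ∣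
  two-needed U V⊆U (_ , U-pds) with any? (λ y → (y ∈? U) ×-dec ¬? (y ≟ᶠ v₀))
  ... | yes (y , y∈U , y≢v₀) = distinct⇒2≤∣p∣ (V⊆U (x∈⁅x⁆ v₀)) y∈U (y≢v₀ ∘ sym)
  ... | no  only-v₀ = case observes-only-v₀ U⊆V (InPD⇒Forced P (U-pds v₁ ∈⊤)) of λ ()
    where
    U⊆V : U ⊆ V
    U⊆V {y} y∈U with y ≟ᶠ v₀
    ... | yes refl = x∈⁅x⁆ v₀
    ... | no  y≢v₀ = ⊥-elim (only-v₀ (y , y∈U , y≢v₀))

  tight : ∃ λ n → Σ (Graph n) λ G′ → ∃ λ V → ∃ λ S → Setting G′ V S ×
            ∃ λ k → IsGammaP G′ ⊤ S k × 3 * k ≡ ThreeBound G′ V S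
  tight = 4 , P , V , V , setting , 2 , ((T , V⊆T , T-pds , refl) , two-needed) , refl
    where
    V⊆T : V ⊆ T
    V⊆T x∈ rewrite x∈⁅y⁆⇒x≡y v₀ x∈ = here

proposition3p10 :
    ((n : ℕ) (G' : Graph n) (V S : Subset n) → Setting G' V S →
      ∃ λ k → IsGammaP G' ⊤ S k × 3 * k ≤ ThreeBound G' V S)
    ×
    (∃ λ n → Σ (Graph n) λ G' → ∃ λ V → ∃ λ S → Setting G' V S ×
      ∃ λ k → IsGammaP G' ⊤ S k × 3 * k ≡ ThreeBound G' V S)
proposition3p10 = (λ _ G′ → γP-upperBound G′) , TightExample.tight
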